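{- Let $h=(A\xrightarrow{\partial_A}H\xleftarrow{\partial_B}B)$ be a morphism $A\to B$ of $\mathrm{Cospan}(\mathbf{UHGraph})_*$ with apex $H=(W,F,\mathrm{ends}_H)$. Let $\phi\colon W\to V$ be a function such that for all $w\ne w'$ in $W$, $\phi(w)=\phi(w')$ implies $w,w'\in\mathrm{im}(\partial_A)\cup\mathrm{im}(\partial_B)$. Let $d$ be a monoidal decomposition of $h$. Let $\Gamma$ be the hypergraph with sources whose hypergraph has vertex set $\mathrm{im}(\phi)$, edge set $F$ and $\mathrm{ends}(e)=\phi(\mathrm{ends}_H(e))$, and whose set of sources is $\phi(\partial_A(A))\cup\phi(\partial_B(B))$. Then there is an inductive branch decomposition $T$ of $\Gamma$ such that $\mathrm{wd}(T)\le2\cdot\max\{\mathrm{wd}(d),|A|,|B|\}$.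
   Context: A hypergraph $G=(V,E,\mathrm{ends})$ has finite sets $V,E$ and $\mathrm{ends}\colon E\to\mathcal P(V)$. Homomorphisms $(\alpha_V,\alpha_E)$ satisfy $\mathrm{ends}_H(\alpha_E(e))=\alpha_V(\mathrm{ends}_G(e))$, forming a category $\mathbf{UHGraph}$ with finite colimits. A subhypergraph is $(V',E',\mathrm{ends}|_{E'})$ with $V'\subseteq V$, $E'\subseteq E$, $\mathrm{ends}(E')\subseteq V'$. $\mathrm{Cospan}(\mathbf{UHGraph})_*$: objects are finite sets (discrete hypergraphs); morphisms $X\to Y$ are isomorphism classes of cospans $X\to G\leftarrow Y$ in $\mathbf{UHGraph}$ (a hypergraph with two functions into its vertex set), composed by pushout, with monoidal product disjoint union. Atoms are all morphisms; weights $w(X)=|X|$ on objects and $w(g)=$ number of vertices of the apex of $g$. Monoidal decompositions $D(f)$ of $f\colon A\to B$: a leaf $(f)$ if $f$ is an atom; $(d_1\otimes d_2)$ with $d_i\in D(f_i)$, $f=f_1\otimes f_2$; $(d_1;_Yd_2)$ with $d_1\in D(f_1\colon A\to Y)$, $d_2\in D(f_2\colon Y\to B)$, $f$ the composite of $f_1$ then $f_2$. Width: $\mathrm{wd}((f))=w(f)$, $\mathrm{wd}(d_1\otimes d_2)=\max\{\mathrm{wd}(d_1),\mathrm{wd}(d_2)\}$, $\mathrm{wd}(d_1;_Yd_2)=\max\{\mathrm{wd}(d_1),w(Y),\mathrm{wd}(d_2)\}$. Hypergraph with sources: $\Gamma=(G,X)$, $X\subseteq V$; subhypergraphs with sources $(G',X')$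 have $G'$ a subhypergraph of $G$ and $X'$ any subset of its vertices. An inductive branch decomposition of $\Gamma=((V,E,\mathrm{ends}),X)$ is: (a) the empty tree if $E=\emptyset$; (b) a leaf labelled $\Gamma$ if $|E|=1$; (c) a root labelled $\Gamma$ with subtrees $T_1,T_2$ that are inductive branch decompositions of subhypergraphs $\Gamma_i=((V_i,E_i,\mathrm{ends}|_{E_i}),X_i)$ with $E=E_1\sqcup E_2$, $V=V_1\cup V_2$, $X_i=(V_1\cap V_2)\cup(X\cap V_i)$. Width: empty tree 0; a tree with root label $(G',X')$ and subtrees $T_1,T_2$ (both empty for a leaf) has width $\max\{\mathrm{wd}(T_1),\mathrm{wd}(T_2),|X'|\}$. -}

module Defs where

open import Data.Nat using (ℕ; _+_; _⊔_)
open import Data.Bool using (Bool; true; false; _∧_)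
open import Data.Fin using (Fin; _≟_; _↑ˡ_; _↑ʳ_; splitAt)
open import Data.Fin.Subset using (Subset; ⊥; ⊤; _∪_; _∩_; _⊆_; _∈_; ∣_∣)
open import Data.Vec using (tabulate; lookup; _++_)
open import Data.List using (allFin)
open import Data.Bool.ListAction using (any)
open import Data.Product using (Σ; ∃; _×_)
open import Data.Sum using (_⊎_; [_,_])
open import Function using (_∘_)
open import Relation.Nullary.Decidable using (⌊_⌋)
open import Relation.Binary.PropositionalEquality using (_≡_; _≗_)

imageSub : ∀ {m n} → (Fin m → Fin n) → Subset m → Subset n
imageSub {m} f S = tabulate λ v → any (λ w → lookup S w ∧ ⌊ f w ≟ v ⌋) (allFin m)

record Hypergraph : Set where
  field
    nV   : ℕ
    nE   : ℕ
    ends : Fin nE → Subset nV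
open Hypergraph public

record Hom (G H : Hypergraph) : Set where
  field
    αV : Fin (nV G) → Fin (nV H)
    αE : Fin (nE G) → Fin (nE H)
    preserves : ∀ e → ends H (αE e) ≡ imageSub αV (ends G e)
open Hom public

-- Cospans A → H ← B in UHGraph with discrete feet A = Fin a, B = Fin b

record Cospan (a b : ℕ) : Set where
  field
    apex : Hypergraph
    ∂A   : Fin a → Fin (nV apex)
    ∂B   : Fin b → Fin (nV apex)
open Cospan public

-- Isomorphism of cospans (morphisms of Cospan(UHGraph)_* are iso classes)
record _≅_ {a b : ℕ} (f g : Cospan a b) : Set where
  field
    to     : Hom (apex f) (apex g)
    from   : Hom (apex g) (apex f)
    fromToV : αV from ∘ αV to ≗ (λ x → x)
    toFromV : αV to ∘ αV from ≗ (λ x → x)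
    fromToE : αE from ∘ αE to ≗ (λ x → x)
    toFromE : αE to ∘ αE from ≗ (λ x → x)
    commA  : αV to ∘ ∂A f ≗ ∂A g
    commB  : αV to ∘ ∂B f ≗ ∂B g

_⊗_ : ∀ {a₁ b₁ a₂ b₂} → Cospan a₁ b₁ → Cospan a₂ b₂ → Cospan (a₁ + a₂) (b₁ + b₂)
_⊗_ {a₁} {b₁} f g = record
  { apex = record
      { nV = nV (apex f) + nV (apex g)
      ; nE = nE (apex f) + nE (apex g)
      ; ends = [ (λ e → ends (apex f) e ++ ⊥) , (λ e → ⊥ ++ ends (apex g) e) ]
               ∘ splitAt (nE (apex f))
      }
  ; ∂A = [ (λ i → ∂A f i ↑ˡ nV (apex g)) , (λ i → nV (apex f) ↑ʳ ∂A g i) ] ∘ splitAt a₁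
  ; ∂B = [ (λ i → ∂B f i ↑ˡ nV (apex g)) , (λ i → nV (apex f) ↑ʳ ∂B g i) ] ∘ splitAt b₁
  }

-- h is (a representative of) the composite f ; g: its apex, together with
-- j₁, j₂, is a pushout in UHGraph of apex f ← Y → apex g (Y discrete),
-- and its legs are the induced ones.
record IsComposite {a y b : ℕ} (f : Cospan a y) (g : Cospan y b) (h : Cospan a b) : Set where
  field
    j₁ : Hom (apex f) (apex h)
    j₂ : Hom (apex g) (apex h)
    glue : ∀ i → αV j₁ (∂B f i) ≡ αV j₂ (∂A g i)
    legA : ∀ i → ∂A h i ≡ αV j₁ (∂A f i)
    legB : ∀ i → ∂B h i ≡ αV j₂ (∂B g i)
    universal : ∀ (K : Hypergraph) (k₁ : Hom (apex f) K) (k₂ : Hom (apex g) K)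
      → (∀ i → αV k₁ (∂B f i) ≡ αV k₂ (∂A g i))
      → Σ (Hom (apex h) K) λ u →
          (αV u ∘ αV j₁ ≗ αV k₁) × (αE u ∘ αE j₁ ≗ αE k₁) ×
          (αV u ∘ αV j₂ ≗ αV k₂) × (αE u ∘ αE j₂ ≗ αE k₂)
    unique : ∀ (K : Hypergraph) (u u' : Hom (apex h) K)
      → (αV u ∘ αV j₁ ≗ αV u' ∘ αV j₁) → (αE u ∘ αE j₁ ≗ αE u' ∘ αE j₁)
      → (αV u ∘ αV j₂ ≗ αV u' ∘ αV j₂) → (αE u ∘ αE j₂ ≗ αE u' ∘ αE j₂)
      → (αV u ≗ αV u') × (αE u ≗ αE u')

-- Monoidal decompositions (every morphism is an atom)

data MDec : {a b : ℕ} → Cospan a b → Set where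
  leaf : ∀ {a b} (f : Cospan a b) → MDec f
  tens : ∀ {a₁ b₁ a₂ b₂} {f₁ : Cospan a₁ b₁} {f₂ : Cospan a₂ b₂}
           {f : Cospan (a₁ + a₂) (b₁ + b₂)}
         → MDec f₁ → MDec f₂ → f ≅ (f₁ ⊗ f₂) → MDec f
  seq  : ∀ {a y b} {f₁ : Cospan a y} {f₂ : Cospan y b} {f : Cospan a b}
         → MDec f₁ → MDec f₂ → IsComposite f₁ f₂ f → MDec f

wd : ∀ {a b} {f : Cospan a b} → MDec f → ℕ
wd (leaf f) = nV (apex f)
wd (tens d₁ d₂ _) = wd d₁ ⊔ wd d₂
wd (seq {y = y} d₁ d₂ _) = wd d₁ ⊔ y ⊔ wd d₂

-- A hypergraph with sources (G', X') that is a subhypergraph of an ambient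
-- hypergraph G is given by its vertex subset V', edge subset E' and sources X'.
-- IBD G V E X : inductive branch decompositions of ((V,E,ends|E), X).

EndsIn : (G : Hypergraph) → Subset (nE G) → Subset (nV G) → Set
EndsIn G E V = ∀ {e} → e ∈ E → ends G e ⊆ V

data IBD (G : Hypergraph) : Subset (nV G) → Subset (nE G) → Subset (nV G) → Set where
  empty : ∀ {V E X} → E ≡ ⊥ → IBD G V E X
  leaf  : ∀ {V E X} → ∣ E ∣ ≡ 1 → IBD G V E X
  node  : ∀ {V E X} (V₁ V₂ : Subset (nV G)) (E₁ E₂ : Subset (nE G))
          → E ≡ E₁ ∪ E₂ → E₁ ∩ E₂ ≡ ⊥ → V ≡ V₁ ∪ V₂
          → EndsIn G E₁ V₁ → EndsIn G E₂ V₂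
          → IBD G V₁ E₁ ((V₁ ∩ V₂) ∪ (X ∩ V₁))
          → IBD G V₂ E₂ ((V₁ ∩ V₂) ∪ (X ∩ V₂))
          → IBD G V E X

wdT : ∀ {G V E X} → IBD G V E X → ℕ
wdT (empty _) = 0
wdT {X = X} (leaf _) = ∣ X ∣
wdT {X = X} (node _ _ _ _ _ _ _ _ _ t₁ t₂) = wdT t₁ ⊔ wdT t₂ ⊔ ∣ X ∣

InBoundary : ∀ {a b} (h : Cospan a b) → Fin (nV (apex h)) → Set
InBoundary h w = (∃ λ i → ∂A h i ≡ w) ⊎ (∃ λ j → ∂B h j ≡ w)

-- ambient hypergraph (V, F, φ ∘ ends_H); Γ lives inside it with vertex set im φ
Γhyp : ∀ {a b n} (h : Cospan a b) → (Fin (nV (apex h)) → Fin n) → Hypergraph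
Γhyp {n = n} h φ = record
  { nV = n ; nE = nE (apex h) ; ends = λ e → imageSub φ (ends (apex h) e) }

Γsources : ∀ {a b n} (h : Cospan a b) → (Fin (nV (apex h)) → Fin n) → Subset n
Γsources h φ = imageSub φ (imageSub (∂A h) ⊤) ∪ imageSub φ (imageSub (∂B h) ⊤)

-- Induct on the monoidal decomposition, proving the bound for the image of the apex under every
-- edge-injective homomorphism that identifies only boundary vertices.  An atom is handled by a
-- caterpillar whose bags are all of its vertices.  A tensor product or composite is glued from its
-- two factors: its edges split between them, and a vertex of a factor that is identified with
-- anything else, or becomes a boundary vertex of the whole, was already a boundary vertex of the
-- factor.  So the images of the two factors can be the children of the root: the sources they
-- receive (shared vertices and inherited sources) are exactly the images of their own boundaries,
-- while the root's sources, the image of the boundary, number at most |A| + |B| ≤ 2·max(…).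
-- For composites the gluing properties are read off the pushout by mapping it into small test
-- hypergraphs.

module Submission where

open import Defs
open import Data.Nat using (ℕ; zero; suc; _+_; _*_; _⊔_; _≤_; z≤n; s≤s)
open import Data.Nat.Properties
  using (module ≤-Reasoning; ≤-trans; ≤-reflexive; +-suc; +-identityʳ; +-mono-≤; m≤n⇒m≤1+n; ⊔-lub
        ; m≤m+n; m+n≤o⇒m≤o; m+n≤o⇒n≤o; m≤m⊔n; m≤n⊔m; m≤n⇒m≤n⊔o; m⊔n≤o⇒m≤o; m⊔n≤o⇒n≤o)
open import Data.Bool using (Bool; true; false; T; _∧_)
open import Data.Bool.Properties using (T-∧; T-≡)
open import Data.Bool.ListAction using (any)
open import Data.List using (allFin)
open import Data.List.Membership.Propositional using (lose)
open import Data.List.Membership.Propositional.Properties using (∈-allFin)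
open import Data.List.Relation.Unary.Any using (satisfied)
open import Data.List.Relation.Unary.Any.Properties using (any⁺; any⁻)
open import Data.Vec using ([]; _∷_; _++_; lookup; here; there)
open import Data.Vec.Properties using (lookup∘tabulate; []=⇒lookup; lookup⇒[]=)
open import Data.Fin using (Fin; zero; suc; _≟_; _↑ˡ_; _↑ʳ_; splitAt)
open import Data.Fin.Properties
  using (splitAt-↑ˡ; splitAt-↑ʳ; splitAt⁻¹-↑ˡ; splitAt⁻¹-↑ʳ; ↑ˡ-injective; ↑ʳ-injective; any?)
open import Data.Fin.Subset using (Subset; ⊥; ⊤; _∪_; _∩_; _─_; _-_; _⊆_; _⊂_; _∈_; _∉_; ∣_∣; ⁅_⁆)
open import Data.Fin.Subset.Properties
open import Data.Fin.Subset.Induction using (⊂-wellFounded; Acc; acc)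
open import Data.Product using (Σ; ∃; _×_; _,_; proj₁; proj₂)
open import Data.Sum using (_⊎_; inj₁; inj₂; [_,_]′)
import Data.Sum as Sum
open import Data.Empty using (⊥-elim)
open import Function using (_∘_; id; Injective; _⇔_; mk⇔; Equivalence)
open import Function.Consequences.Propositional using (inverseʳ⇒injective; strictlyInverseʳ⇒inverseʳ)
open import Relation.Nullary using (¬_; Dec; yes; no)
open import Relation.Nullary.Decidable using (⌊_⌋; toWitness; fromWitness; _⊎-dec_; decidable-stable)
open import Relation.Binary.PropositionalEquality

-- Images of subsets

image : ∀ {m n} → (Fin m → Fin n) → Subset n
image f = imageSub f ⊤

module _ {m n} (f : Fin m → Fin n) where

  private
    hits : Subset m → Fin n → Fin m → Bool
    hits S v w = lookup S w ∧ ⌊ f w ≟ v ⌋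

    ∈-imageSub⇔ : ∀ S v → v ∈ imageSub f S ⇔ T (any (hits S v) (allFin m))
    ∈-imageSub⇔ S v = mk⇔
      (λ v∈ → Equivalence.from T-≡ (trans (sym (lookup∘tabulate _ v)) ([]=⇒lookup v∈)))
      (λ t → lookup⇒[]= v _ (trans (lookup∘tabulate _ v) (Equivalence.to T-≡ t)))

  ∈-imageSub⁻ : ∀ S {v} → v ∈ imageSub f S → ∃ λ w → w ∈ S × f w ≡ v
  ∈-imageSub⁻ S {v} v∈ with satisfied (any⁻ (hits S v) (allFin m) (Equivalence.to (∈-imageSub⇔ S v) v∈))
  ... | w , t with Equivalence.to T-∧ t
  ... | w∈S , fw≡v = w , lookup⇒[]= w S (Equivalence.to T-≡ w∈S) , toWitness fw≡v

  ∈-imageSub⁺ : ∀ {S w} → w ∈ S → f w ∈ imageSub f S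
  ∈-imageSub⁺ {S} {w} w∈ = Equivalence.from (∈-imageSub⇔ S (f w)) (any⁺ (hits S (f w)) (lose (∈-allFin w) hit))
    where
    hit : T (hits S (f w) w)
    hit = Equivalence.from T-∧ (Equivalence.from T-≡ ([]=⇒lookup w∈) , fromWitness refl)

  ∈-image⁺ : ∀ w → f w ∈ image f
  ∈-image⁺ w = ∈-imageSub⁺ ∈⊤

  ∈-image⁻ : ∀ {v} → v ∈ image f → ∃ λ w → f w ≡ v
  ∈-image⁻ v∈ with ∈-imageSub⁻ ⊤ v∈
  ... | w , _ , fw≡v = w , fw≡v

  imageSub-mono : ∀ {S S'} → S ⊆ S' → imageSub f S ⊆ imageSub f S'
  imageSub-mono {S} S⊆S' v∈ with ∈-imageSub⁻ S v∈
  ... | w , w∈S , refl = ∈-imageSub⁺ (S⊆S' w∈S)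

imageSub-∘ : ∀ {l m n} (g : Fin m → Fin n) (f : Fin l → Fin m) S →
             imageSub g (imageSub f S) ≡ imageSub (g ∘ f) S
imageSub-∘ g f S = ⊆-antisym l⊆r r⊆l
  where
  l⊆r : imageSub g (imageSub f S) ⊆ imageSub (g ∘ f) S
  l⊆r v∈ with ∈-imageSub⁻ g (imageSub f S) v∈
  ... | _ , u∈ , refl with ∈-imageSub⁻ f S u∈
  ... | w , w∈ , refl = ∈-imageSub⁺ (g ∘ f) w∈
  r⊆l : imageSub (g ∘ f) S ⊆ imageSub g (imageSub f S)
  r⊆l v∈ with ∈-imageSub⁻ (g ∘ f) S v∈
  ... | w , w∈ , refl = ∈-imageSub⁺ g (∈-imageSub⁺ f w∈)

imageSub-id : ∀ {n} (S : Subset n) → imageSub id S ≡ S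
imageSub-id S = ⊆-antisym l⊆r (∈-imageSub⁺ id)
  where
  l⊆r : imageSub id S ⊆ S
  l⊆r v∈ with ∈-imageSub⁻ id S v∈
  ... | _ , w∈ , refl = w∈

image-∘⊆ : ∀ {l m n} (g : Fin m → Fin n) {f : Fin l → Fin m} → image (g ∘ f) ⊆ image g
image-∘⊆ g {f} v∈ with ∈-image⁻ (g ∘ f) v∈
... | w , refl = ∈-image⁺ g (f w)

image-∘-surjective : ∀ {l m n} (g : Fin m → Fin n) {f : Fin l → Fin m} →
                     (∀ u → ∃ λ w → f w ≡ u) → image (g ∘ f) ≡ image g
image-∘-surjective g {f} surj = ⊆-antisym (image-∘⊆ g {f}) r⊆l
  where
  r⊆l : image g ⊆ image (g ∘ f)
  r⊆l v∈ with ∈-image⁻ g v∈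
  ... | u , refl with surj u
  ... | w , refl = ∈-image⁺ (g ∘ f) w

∣p∪q∣≤∣p∣+∣q∣ : ∀ {n} (p q : Subset n) → ∣ p ∪ q ∣ ≤ ∣ p ∣ + ∣ q ∣
∣p∪q∣≤∣p∣+∣q∣ []          []          = z≤n
∣p∪q∣≤∣p∣+∣q∣ (true ∷ p)  (true ∷ q)  =
  s≤s (≤-trans (m≤n⇒m≤1+n (∣p∪q∣≤∣p∣+∣q∣ p q)) (≤-reflexive (sym (+-suc ∣ p ∣ ∣ q ∣))))
∣p∪q∣≤∣p∣+∣q∣ (true ∷ p)  (false ∷ q) = s≤s (∣p∪q∣≤∣p∣+∣q∣ p q)
∣p∪q∣≤∣p∣+∣q∣ (false ∷ p) (true ∷ q)  =
  ≤-trans (s≤s (∣p∪q∣≤∣p∣+∣q∣ p q)) (≤-reflexive (sym (+-suc ∣ p ∣ ∣ q ∣)))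
∣p∪q∣≤∣p∣+∣q∣ (false ∷ p) (false ∷ q) = ∣p∪q∣≤∣p∣+∣q∣ p q

∣image∣≤m : ∀ {m n} (f : Fin m → Fin n) → ∣ image f ∣ ≤ m
∣image∣≤m {zero} {n} f = ≤-trans (p⊆q⇒∣p∣≤∣q∣ ⊆⊥) (≤-reflexive (∣⊥∣≡0 n))
  where
  ⊆⊥ : image f ⊆ ⊥
  ⊆⊥ v∈ with ∈-image⁻ f v∈
  ... | () , _
∣image∣≤m {suc m} f = begin
  ∣ image f ∣                             ≤⟨ p⊆q⇒∣p∣≤∣q∣ split ⟩
  ∣ ⁅ f zero ⁆ ∪ image (f ∘ suc) ∣        ≤⟨ ∣p∪q∣≤∣p∣+∣q∣ ⁅ f zero ⁆ (image (f ∘ suc)) ⟩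
  ∣ ⁅ f zero ⁆ ∣ + ∣ image (f ∘ suc) ∣    ≤⟨ +-mono-≤ (≤-reflexive (∣⁅x⁆∣≡1 (f zero))) (∣image∣≤m (f ∘ suc)) ⟩
  suc m                                   ∎
  where
  open ≤-Reasoning
  split : image f ⊆ ⁅ f zero ⁆ ∪ image (f ∘ suc)
  split v∈ with ∈-image⁻ f v∈
  ... | zero  , refl = x∈p∪q⁺ (inj₁ (x∈⁅x⁆ (f zero)))
  ... | suc w , refl = x∈p∪q⁺ (inj₂ (∈-image⁺ (f ∘ suc) w))

module _ {l₁ l₂ m n} (g : Fin m → Fin n) {f₁ : Fin l₁ → Fin m} {f₂ : Fin l₂ → Fin m} where

  image-∘-∪⊆ : image (g ∘ f₁) ∪ image (g ∘ f₂) ⊆ image g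
  image-∘-∪⊆ v∈ with x∈p∪q⁻ (image (g ∘ f₁)) _ v∈
  ... | inj₁ v∈₁ = image-∘⊆ g {f₁} v∈₁
  ... | inj₂ v∈₂ = image-∘⊆ g {f₂} v∈₂

  image-∘-cover : (∀ u → (∃ λ w → f₁ w ≡ u) ⊎ (∃ λ w → f₂ w ≡ u)) →
                  image g ≡ image (g ∘ f₁) ∪ image (g ∘ f₂)
  image-∘-cover cover = ⊆-antisym l⊆r image-∘-∪⊆
    where
    l⊆r : image g ⊆ image (g ∘ f₁) ∪ image (g ∘ f₂)
    l⊆r v∈ with ∈-image⁻ g v∈
    ... | u , refl with cover u
    ...   | inj₁ (w , refl) = x∈p∪q⁺ (inj₁ (∈-image⁺ (g ∘ f₁) w))
    ...   | inj₂ (w , refl) = x∈p∪q⁺ (inj₂ (∈-image⁺ (g ∘ f₂) w))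

  image-∘-disjoint : Injective _≡_ _≡_ g → (∀ w₁ w₂ → f₁ w₁ ≢ f₂ w₂) →
                     image (g ∘ f₁) ∩ image (g ∘ f₂) ≡ ⊥
  image-∘-disjoint g-inj disjoint = Empty-unique λ (v , v∈) →
    let v∈₁ , v∈₂ = x∈p∩q⁻ (image (g ∘ f₁)) _ v∈
        w₁ , eq₁  = ∈-image⁻ (g ∘ f₁) v∈₁
        w₂ , eq₂  = ∈-image⁻ (g ∘ f₂) v∈₂
    in disjoint w₁ w₂ (g-inj (trans eq₁ (sym eq₂)))

-- Building branch decompositions

x∈p─q⇒x∉q : ∀ {n} {x : Fin n} (p q : Subset n) → x ∈ p ─ q → x ∉ q
x∈p─q⇒x∉q (true  ∷ p) (false ∷ q) here      ()
x∈p─q⇒x∉q (_     ∷ p) (_     ∷ q) (there x∈) (there x∈q) = x∈p─q⇒x∉q p q x∈ x∈q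

p∩[q─p]≡⊥ : ∀ {n} (p q : Subset n) → p ∩ (q ─ p) ≡ ⊥
p∩[q─p]≡⊥ p q = Empty-unique λ (x , x∈) →
  let x∈p , x∈q─p = x∈p∩q⁻ p (q ─ p) x∈ in x∈p─q⇒x∉q q p x∈q─p x∈p

p⊆q⇒p∩q≡p : ∀ {n} {p q : Subset n} → p ⊆ q → p ∩ q ≡ p
p⊆q⇒p∩q≡p {p = p} {q} p⊆q = ⊆-antisym (p∩q⊆p p q) (λ x∈p → x∈p∩q⁺ (x∈p , p⊆q x∈p))

p⊆q⇒p∪[q─p]≡q : ∀ {n} {p q : Subset n} → p ⊆ q → p ∪ (q ─ p) ≡ q
p⊆q⇒p∪[q─p]≡q {p = p} {q} p⊆q = ⊆-antisym l⊆r r⊆l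
  where
  l⊆r : p ∪ (q ─ p) ⊆ q
  l⊆r x∈ with x∈p∪q⁻ p (q ─ p) x∈
  ... | inj₁ x∈p   = p⊆q x∈p
  ... | inj₂ x∈q─p = p─q⊆p q p x∈q─p
  r⊆l : q ⊆ p ∪ (q ─ p)
  r⊆l {x} x∈q with x ∈? p
  ... | yes x∈p = x∈p∪q⁺ (inj₁ x∈p)
  ... | no  x∉p = x∈p∪q⁺ (inj₂ (x∈p∧x∉q⇒x∈p─q x∈q x∉p))

IBD≤ : (G : Hypergraph) → Subset (nV G) → Subset (nE G) → Subset (nV G) → ℕ → Set
IBD≤ G V E X k = Σ (IBD G V E X) λ T → wdT T ≤ k

module _ {G : Hypergraph} where

  IBD≤-cast : ∀ {V V' E E' X X' k} → V ≡ V' → E ≡ E' → X ≡ X' → IBD≤ G V E X k → IBD≤ G V' E' X' k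
  IBD≤-cast refl refl refl T = T

  node≤ : ∀ {V E X k} V₁ V₂ E₁ E₂ → E ≡ E₁ ∪ E₂ → E₁ ∩ E₂ ≡ ⊥ → V ≡ V₁ ∪ V₂
          → EndsIn G E₁ V₁ → EndsIn G E₂ V₂
          → IBD≤ G V₁ E₁ ((V₁ ∩ V₂) ∪ (X ∩ V₁)) k
          → IBD≤ G V₂ E₂ ((V₁ ∩ V₂) ∪ (X ∩ V₂)) k
          → ∣ X ∣ ≤ k → IBD≤ G V E X k
  node≤ V₁ V₂ E₁ E₂ E≡ E₁∩E₂≡⊥ V≡ ends₁ ends₂ (T₁ , T₁≤) (T₂ , T₂≤) ∣X∣≤ =
    node V₁ V₂ E₁ E₂ E≡ E₁∩E₂≡⊥ V≡ ends₁ ends₂ T₁ T₂ , ⊔-lub (⊔-lub T₁≤ T₂≤) ∣X∣≤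

  endsIn-∪ : ∀ {E E₁ E₂ V₁ V₂} → E ≡ E₁ ∪ E₂ → EndsIn G E₁ V₁ → EndsIn G E₂ V₂ → EndsIn G E (V₁ ∪ V₂)
  endsIn-∪ {E₁ = E₁} {E₂} refl ends₁ ends₂ e∈ with x∈p∪q⁻ E₁ E₂ e∈
  ... | inj₁ e∈₁ = p⊆p∪q _ ∘ ends₁ e∈₁
  ... | inj₂ e∈₂ = q⊆p∪q _ _ ∘ ends₂ e∈₂

  childSources⊆ : ∀ (V₁ V₂ X : Subset (nV G)) → (V₁ ∩ V₂) ∪ (X ∩ V₁) ⊆ V₁
  childSources⊆ V₁ V₂ X x∈ with x∈p∪q⁻ (V₁ ∩ V₂) (X ∩ V₁) x∈
  ... | inj₁ x∈V₁∩V₂ = p∩q⊆p V₁ V₂ x∈V₁∩V₂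
  ... | inj₂ x∈X∩V₁  = p∩q⊆q X V₁ x∈X∩V₁

  caterpillar : ∀ {V X} E → EndsIn G E V → X ⊆ V → IBD≤ G V E X ∣ V ∣
  caterpillar {V} E = go E (⊂-wellFounded E)
    where
    go : ∀ {X} E → Acc _⊂_ E → EndsIn G E V → X ⊆ V → IBD≤ G V E X ∣ V ∣
    go E _ ends X⊆V with nonempty? E
    ... | no E-empty = empty (Empty-unique E-empty) , z≤n
    go {X} E (acc rec) ends X⊆V | yes (x , x∈E) =
      node≤ V V ⁅ x ⁆ (E - x) (sym (p⊆q⇒p∪[q─p]≡q ⁅x⁆⊆E)) (p∩[q─p]≡⊥ ⁅ x ⁆ E) (sym (∪-idem V))
        (ends ∘ ⁅x⁆⊆E) (ends ∘ p─q⊆p E ⁅ x ⁆)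
        (leaf (∣⁅x⁆∣≡1 x) , p⊆q⇒∣p∣≤∣q∣ (childSources⊆ V V X))
        (go (E - x) (rec (x∈p⇒p-x⊂p x∈E)) (ends ∘ p─q⊆p E ⁅ x ⁆) (childSources⊆ V V X))
        (p⊆q⇒∣p∣≤∣q∣ X⊆V)
      where
      ⁅x⁆⊆E : ⁅ x ⁆ ⊆ E
      ⁅x⁆⊆E y∈ rewrite x∈⁅y⁆⇒x≡y x y∈ = x∈E

  widen : ∀ {V V₁ E X k} → V₁ ⊆ V → X ⊆ V₁ → EndsIn G E V₁ → IBD≤ G V₁ E X k → ∣ X ∣ ≤ k → IBD≤ G V E X k
  widen {V} {V₁} {E} {X} V₁⊆V X⊆V₁ ends T ∣X∣≤ =
    node≤ V₁ (V ─ V₁) E ⊥ (sym (∪-identityʳ E)) (∩-zeroʳ E) (sym (p⊆q⇒p∪[q─p]≡q V₁⊆V))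
      ends (λ e∈⊥ → ⊥-elim (∉⊥ e∈⊥)) (IBD≤-cast refl refl X≡ T) (empty refl , z≤n) ∣X∣≤
    where
    open ≡-Reasoning
    X≡ : X ≡ (V₁ ∩ (V ─ V₁)) ∪ (X ∩ V₁)
    X≡ = begin
      X                          ≡⟨ p⊆q⇒p∩q≡p X⊆V₁ ⟨
      X ∩ V₁                     ≡⟨ ∪-identityˡ (X ∩ V₁) ⟨
      ⊥ ∪ (X ∩ V₁)               ≡⟨ cong (_∪ (X ∩ V₁)) (p∩[q─p]≡⊥ V₁ V) ⟨
      (V₁ ∩ (V ─ V₁)) ∪ (X ∩ V₁) ∎

-- The inductive invariant

_∘ʰ_ : ∀ {F G H} → Hom G H → Hom F G → Hom F H
_∘ʰ_ {F} m j = record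
  { αV = αV m ∘ αV j
  ; αE = αE m ∘ αE j
  ; preserves = λ e → trans (preserves m (αE j e))
      (trans (cong (imageSub (αV m)) (preserves j e)) (imageSub-∘ (αV m) (αV j) (ends F e)))
  }

endsIn-image : ∀ {H G} (m : Hom H G) → EndsIn G (image (αE m)) (image (αV m))
endsIn-image {H} m e∈ with ∈-image⁻ (αE m) e∈
... | e , refl rewrite preserves m e = imageSub-mono (αV m) {ends H e} ⊆⊤

module _ {a b} (h : Cospan a b) where

  IdentifiesOnlyBoundary : ∀ {n} → (Fin (nV (apex h)) → Fin n) → Set
  IdentifiesOnlyBoundary φ = ∀ w w' → w ≢ w' → φ w ≡ φ w' → InBoundary h w × InBoundary h w'

  -- Quantifying over every ambient hypergraph G lets the children of a gluing, which live in the
  -- ambient hypergraph of the whole, be produced by the induction hypothesis.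
  Decomposable : ℕ → Set
  Decomposable k = ∀ {G : Hypergraph} (m : Hom (apex h) G)
                   → Injective _≡_ _≡_ (αE m) → IdentifiesOnlyBoundary (αV m)
                   → IBD≤ G (image (αV m)) (image (αE m)) (Γsources h (αV m)) k

  module _ {n} (φ : Fin (nV (apex h)) → Fin n) where

    ∈-Γsources⁺ : ∀ {w} → InBoundary h w → φ w ∈ Γsources h φ
    ∈-Γsources⁺ (inj₁ (i , refl)) = x∈p∪q⁺ (inj₁ (∈-imageSub⁺ φ (∈-image⁺ (∂A h) i)))
    ∈-Γsources⁺ (inj₂ (j , refl)) = x∈p∪q⁺ (inj₂ (∈-imageSub⁺ φ (∈-image⁺ (∂B h) j)))

    ∈-Γsources⁻ : ∀ {x} → x ∈ Γsources h φ → ∃ λ w → InBoundary h w × φ w ≡ x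
    ∈-Γsources⁻ x∈ with x∈p∪q⁻ (imageSub φ (image (∂A h))) _ x∈
    ... | inj₁ x∈A with ∈-imageSub⁻ φ (image (∂A h)) x∈A
    ...   | w , w∈ , φw≡x with ∈-image⁻ (∂A h) w∈
    ...     | i , ∂Ai≡w = w , inj₁ (i , ∂Ai≡w) , φw≡x
    ∈-Γsources⁻ x∈ | inj₂ x∈B with ∈-imageSub⁻ φ (image (∂B h)) x∈B
    ...   | w , w∈ , φw≡x with ∈-image⁻ (∂B h) w∈
    ...     | j , ∂Bj≡w = w , inj₂ (j , ∂Bj≡w) , φw≡x

    Γsources⊆image : Γsources h φ ⊆ image φ
    Γsources⊆image x∈ with ∈-Γsources⁻ x∈
    ... | w , _ , refl = ∈-image⁺ φ w

    ∣Γsources∣≤a+b : ∣ Γsources h φ ∣ ≤ a + b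
    ∣Γsources∣≤a+b rewrite imageSub-∘ φ (∂A h) ⊤ | imageSub-∘ φ (∂B h) ⊤ =
      ≤-trans (∣p∪q∣≤∣p∣+∣q∣ (image (φ ∘ ∂A h)) _) (+-mono-≤ (∣image∣≤m (φ ∘ ∂A h)) (∣image∣≤m (φ ∘ ∂B h)))

  decomposable-mono : ∀ {k k'} → k ≤ k' → Decomposable k → Decomposable k'
  decomposable-mono k≤k' D m inj onlyBoundary with D m inj onlyBoundary
  ... | T , T≤k = T , ≤-trans T≤k k≤k'

  decomposable-atom : Decomposable (nV (apex h))
  decomposable-atom m _ _ with caterpillar (image (αE m)) (endsIn-image m) (Γsources⊆image (αV m))
  ... | T , T≤ = T , ≤-trans T≤ (∣image∣≤m (αV m))

InBoundary-map : ∀ {a b} {f g : Cospan a b} (t : Fin (nV (apex f)) → Fin (nV (apex g)))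
                 → t ∘ ∂A f ≗ ∂A g → t ∘ ∂B f ≗ ∂B g → ∀ {v} → InBoundary f v → InBoundary g (t v)
InBoundary-map t tA tB (inj₁ (i , refl)) = inj₁ (i , sym (tA i))
InBoundary-map t tA tB (inj₂ (j , refl)) = inj₂ (j , sym (tB j))

module _ {a b} {f g : Cospan a b} (iso : f ≅ g) where

  open _≅_ iso

  private
    to-boundary : ∀ {v} → InBoundary f v → InBoundary g (αV to v)
    to-boundary = InBoundary-map {f = f} {g} (αV to) commA commB

    from-boundary : ∀ {w} → InBoundary g w → InBoundary f (αV from w)
    from-boundary = InBoundary-map {f = g} {f} (αV from) fromA fromB
      where
      fromA : αV from ∘ ∂A g ≗ ∂A f
      fromA i = trans (cong (αV from) (sym (commA i))) (fromToV (∂A f i))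
      fromB : αV from ∘ ∂B g ≗ ∂B f
      fromB j = trans (cong (αV from) (sym (commB j))) (fromToV (∂B f j))

  αV-from-injective : Injective _≡_ _≡_ (αV from)
  αV-from-injective = inverseʳ⇒injective (αV from) (strictlyInverseʳ⇒inverseʳ {f⁻¹ = αV to} (αV from) toFromV)

  αE-from-injective : Injective _≡_ _≡_ (αE from)
  αE-from-injective = inverseʳ⇒injective (αE from) (strictlyInverseʳ⇒inverseʳ {f⁻¹ = αE to} (αE from) toFromE)

  identifiesOnlyBoundary-≅ : ∀ {n} {φ : Fin (nV (apex f)) → Fin n} →
                             IdentifiesOnlyBoundary f φ → IdentifiesOnlyBoundary g (φ ∘ αV from)
  identifiesOnlyBoundary-≅ onlyBoundary w w' w≢w' eq
    with onlyBoundary (αV from w) (αV from w') (w≢w' ∘ αV-from-injective) eq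
  ... | bw , bw' = reflect bw , reflect bw'
    where
    reflect : ∀ {w} → InBoundary f (αV from w) → InBoundary g w
    reflect {w} bw = subst (InBoundary g) (toFromV w) (to-boundary bw)

  Γsources-≅ : ∀ {n} (φ : Fin (nV (apex f)) → Fin n) → Γsources g (φ ∘ αV from) ≡ Γsources f φ
  Γsources-≅ φ = ⊆-antisym l⊆r r⊆l
    where
    l⊆r : Γsources g (φ ∘ αV from) ⊆ Γsources f φ
    l⊆r x∈ with ∈-Γsources⁻ g (φ ∘ αV from) x∈
    ... | w , bw , refl = ∈-Γsources⁺ f φ (from-boundary bw)
    r⊆l : Γsources f φ ⊆ Γsources g (φ ∘ αV from)
    r⊆l x∈ with ∈-Γsources⁻ f φ x∈
    ... | v , bv , refl = subst (_∈ Γsources g (φ ∘ αV from)) (cong φ (fromToV v))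
                            (∈-Γsources⁺ g (φ ∘ αV from) (to-boundary bv))

  decomposable-≅ : ∀ {k} → Decomposable g k → Decomposable f k
  decomposable-≅ D m inj onlyBoundary =
    IBD≤-cast (image-∘-surjective (αV m) (λ v → αV to v , fromToV v))
              (image-∘-surjective (αE m) (λ e → αE to e , fromToE e))
              (Γsources-≅ (αV m))
              (D (m ∘ʰ from) (αE-from-injective ∘ inj) (identifiesOnlyBoundary-≅ onlyBoundary))

-- Gluing two decompositions

record Gluing {a₁ b₁ a₂ b₂ a b} (f₁ : Cospan a₁ b₁) (f₂ : Cospan a₂ b₂) (h : Cospan a b) : Set where
  field
    j₁ : Hom (apex f₁) (apex h)
    j₂ : Hom (apex f₂) (apex h)
    injective₁ : Injective _≡_ _≡_ (αE j₁)
    injective₂ : Injective _≡_ _≡_ (αE j₂)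
    disjoint   : ∀ e₁ e₂ → αE j₁ e₁ ≢ αE j₂ e₂
    covering   : ∀ e → (∃ λ e₁ → αE j₁ e₁ ≡ e) ⊎ (∃ λ e₂ → αE j₂ e₂ ≡ e)
    boundary-reflected : ∀ {v} → InBoundary h v →
      (∃ λ w → InBoundary f₁ w × αV j₁ w ≡ v) ⊎ (∃ λ u → InBoundary f₂ u × αV j₂ u ≡ v)
    boundary-preserved₁ : ∀ {w} → InBoundary f₁ w → InBoundary h (αV j₁ w) ⊎ (∃ λ u → αV j₁ w ≡ αV j₂ u)
    boundary-preserved₂ : ∀ {u} → InBoundary f₂ u → InBoundary h (αV j₂ u) ⊎ (∃ λ w → αV j₂ u ≡ αV j₁ w)
    glued-across₁ : ∀ {w u} → αV j₁ w ≡ αV j₂ u → InBoundary f₁ w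
    glued-across₂ : ∀ {u w} → αV j₂ u ≡ αV j₁ w → InBoundary f₂ u
    glued-within₁ : ∀ {w w'} → αV j₁ w ≡ αV j₁ w' → w ≢ w' → InBoundary f₁ w
    glued-within₂ : ∀ {u u'} → αV j₂ u ≡ αV j₂ u' → u ≢ u' → InBoundary f₂ u

module _ {a₁ b₁ a₂ b₂ a b} {f₁ : Cospan a₁ b₁} {f₂ : Cospan a₂ b₂} {h : Cospan a b}
         (gl : Gluing f₁ f₂ h) where

  open Gluing gl

  Gluing-swap : Gluing f₂ f₁ h
  Gluing-swap = record
    { j₁ = j₂
    ; j₂ = j₁
    ; injective₁ = injective₂
    ; injective₂ = injective₁
    ; disjoint = λ e₂ e₁ → disjoint e₁ e₂ ∘ sym
    ; covering = Sum.swap ∘ covering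
    ; boundary-reflected = Sum.swap ∘ boundary-reflected
    ; boundary-preserved₁ = boundary-preserved₂
    ; boundary-preserved₂ = boundary-preserved₁
    ; glued-across₁ = glued-across₂
    ; glued-across₂ = glued-across₁
    ; glued-within₁ = glued-within₂
    ; glued-within₂ = glued-within₁
    }

  boundary-reflected₁ : ∀ {w} → InBoundary h (αV j₁ w) → InBoundary f₁ w
  boundary-reflected₁ {w} bh with boundary-reflected bh
  ... | inj₂ (u , _ , eq) = glued-across₁ (sym eq)
  ... | inj₁ (w' , bw' , eq) with w' ≟ w
  ...   | yes refl = bw'
  ...   | no w'≢w = glued-within₁ (sym eq) (w'≢w ∘ sym)

  module _ {n} {φ : Fin (nV (apex h)) → Fin n} (onlyBoundary : IdentifiesOnlyBoundary h φ) where

    identifiesOnlyBoundary₁ : IdentifiesOnlyBoundary f₁ (φ ∘ αV j₁)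
    identifiesOnlyBoundary₁ w w' w≢w' eq with αV j₁ w ≟ αV j₁ w'
    ... | yes same = glued-within₁ same w≢w' , glued-within₁ (sym same) (w≢w' ∘ sym)
    ... | no differ with onlyBoundary _ _ differ eq
    ...   | bw , bw' = boundary-reflected₁ bw , boundary-reflected₁ bw'

    private
      V₁ V₂ X : Subset n
      V₁ = image (φ ∘ αV j₁)
      V₂ = image (φ ∘ αV j₂)
      X  = Γsources h φ

      boundary-if-collides : ∀ {w v} → φ (αV j₁ w) ≡ φ v → (αV j₁ w ≡ v → InBoundary f₁ w) → InBoundary f₁ w
      boundary-if-collides {w} {v} eq same⇒bw with αV j₁ w ≟ v
      ... | yes same = same⇒bw same
      ... | no differ = boundary-reflected₁ (proj₁ (onlyBoundary _ _ differ eq))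

    Γsources₁-split : Γsources f₁ (φ ∘ αV j₁) ≡ (V₁ ∩ V₂) ∪ (X ∩ V₁)
    Γsources₁-split = ⊆-antisym l⊆r r⊆l
      where
      l⊆r : ∀ {x} → x ∈ Γsources f₁ (φ ∘ αV j₁) → x ∈ (V₁ ∩ V₂) ∪ (X ∩ V₁)
      l⊆r x∈ with ∈-Γsources⁻ f₁ (φ ∘ αV j₁) x∈
      ... | w , bw , refl with boundary-preserved₁ bw
      ...   | inj₁ bh = x∈p∪q⁺ (inj₂ (x∈p∩q⁺ (∈-Γsources⁺ h φ bh , ∈-image⁺ (φ ∘ αV j₁) w)))
      ...   | inj₂ (u , eq) = x∈p∪q⁺ (inj₁ (x∈p∩q⁺ (∈-image⁺ (φ ∘ αV j₁) w ,
                                subst (_∈ V₂) (cong φ (sym eq)) (∈-image⁺ (φ ∘ αV j₂) u))))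
      r⊆l : ∀ {x} → x ∈ (V₁ ∩ V₂) ∪ (X ∩ V₁) → x ∈ Γsources f₁ (φ ∘ αV j₁)
      r⊆l x∈ with x∈p∪q⁻ (V₁ ∩ V₂) (X ∩ V₁) x∈
      ... | inj₁ x∈V₁∩V₂ with x∈p∩q⁻ V₁ V₂ x∈V₁∩V₂
      ...   | x∈V₁ , x∈V₂ with ∈-image⁻ (φ ∘ αV j₁) x∈V₁ | ∈-image⁻ (φ ∘ αV j₂) x∈V₂
      ...     | w , refl | u , eq =
                ∈-Γsources⁺ f₁ (φ ∘ αV j₁) (boundary-if-collides (sym eq) glued-across₁)
      r⊆l x∈ | inj₂ x∈X∩V₁ with x∈p∩q⁻ X V₁ x∈X∩V₁
      ...   | x∈X , x∈V₁ with ∈-image⁻ (φ ∘ αV j₁) x∈V₁ | ∈-Γsources⁻ h φ x∈X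
      ...     | w , refl | v , bv , eq =
                ∈-Γsources⁺ f₁ (φ ∘ αV j₁)
                  (boundary-if-collides (sym eq) λ same → boundary-reflected₁ (subst (InBoundary h) (sym same) bv))

    Γsources⊆V₁∪V₂ : Γsources h φ ⊆ V₁ ∪ V₂
    Γsources⊆V₁∪V₂ x∈ with ∈-Γsources⁻ h φ x∈
    ... | v , bv , refl with boundary-reflected bv
    ...   | inj₁ (w , _ , refl) = x∈p∪q⁺ (inj₁ (∈-image⁺ (φ ∘ αV j₁) w))
    ...   | inj₂ (u , _ , refl) = x∈p∪q⁺ (inj₂ (∈-image⁺ (φ ∘ αV j₂) u))

decomposable-glue : ∀ {a₁ b₁ a₂ b₂ a b k} {f₁ : Cospan a₁ b₁} {f₂ : Cospan a₂ b₂} {h : Cospan a b}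
  → Gluing f₁ f₂ h → Decomposable f₁ k → Decomposable f₂ k → a + b ≤ k → Decomposable h k
decomposable-glue {k = k} {f₁} {f₂} {h} gl D₁ D₂ a+b≤k {G} m inj onlyBoundary =
  widen (image-∘-∪⊆ (αV m) {αV j₁} {αV j₂}) (Γsources⊆V₁∪V₂ gl onlyBoundary) (endsIn-∪ E≡ ends₁ ends₂)
    (node≤ V₁ V₂ (image (αE m₁)) (image (αE m₂)) E≡ (image-∘-disjoint (αE m) {αE j₁} {αE j₂} inj disjoint)
      refl ends₁ ends₂ T₁ T₂ ∣X∣≤k)
    ∣X∣≤k
  where
  open Gluing gl
  m₁ : Hom (apex f₁) G
  m₁ = m ∘ʰ j₁
  m₂ : Hom (apex f₂) G
  m₂ = m ∘ʰ j₂
  V₁ V₂ X : Subset (nV G)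
  V₁ = image (αV m₁)
  V₂ = image (αV m₂)
  X  = Γsources h (αV m)
  ends₁ : EndsIn G (image (αE m₁)) V₁
  ends₁ = endsIn-image m₁
  ends₂ : EndsIn G (image (αE m₂)) V₂
  ends₂ = endsIn-image m₂
  E≡ : image (αE m) ≡ image (αE m₁) ∪ image (αE m₂)
  E≡ = image-∘-cover (αE m) covering
  ∣X∣≤k : ∣ X ∣ ≤ k
  ∣X∣≤k = ≤-trans (∣Γsources∣≤a+b h (αV m)) a+b≤k
  T₁ : IBD≤ G V₁ (image (αE m₁)) ((V₁ ∩ V₂) ∪ (X ∩ V₁)) k
  T₁ = IBD≤-cast refl refl (Γsources₁-split gl onlyBoundary)
         (D₁ m₁ (injective₁ ∘ inj) (identifiesOnlyBoundary₁ gl onlyBoundary))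
  T₂ : IBD≤ G V₂ (image (αE m₂)) ((V₁ ∩ V₂) ∪ (X ∩ V₂)) k
  T₂ = IBD≤-cast refl refl
         (trans (Γsources₁-split (Gluing-swap gl) onlyBoundary) (cong (_∪ (X ∩ V₂)) (∩-comm V₂ V₁)))
         (D₂ m₂ (injective₂ ∘ inj) (identifiesOnlyBoundary₁ (Gluing-swap gl) onlyBoundary))

-- Tensor products

↑ˡ≢↑ʳ : ∀ {m n} (i : Fin m) (j : Fin n) → i ↑ˡ n ≢ m ↑ʳ j
↑ˡ≢↑ʳ {m} {n} i j eq with trans (sym (splitAt-↑ˡ m i n)) (trans (cong (splitAt m) eq) (splitAt-↑ʳ m n j))
... | ()

∈-++⁺ˡ : ∀ {m n} {S : Subset m} {T : Subset n} {w} → w ∈ S → w ↑ˡ n ∈ S ++ T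
∈-++⁺ˡ here       = here
∈-++⁺ˡ (there w∈) = there (∈-++⁺ˡ w∈)

∈-++⁺ʳ : ∀ {m n} (S : Subset m) {T : Subset n} {w} → w ∈ T → m ↑ʳ w ∈ S ++ T
∈-++⁺ʳ []      w∈ = w∈
∈-++⁺ʳ (_ ∷ S) w∈ = there (∈-++⁺ʳ S w∈)

∈-++⁻ : ∀ {m n} (S : Subset m) {T : Subset n} {v} → v ∈ S ++ T →
        (∃ λ w → w ∈ S × w ↑ˡ n ≡ v) ⊎ (∃ λ w → w ∈ T × m ↑ʳ w ≡ v)
∈-++⁻ []         v∈ = inj₂ (_ , v∈ , refl)
∈-++⁻ (true ∷ S) here = inj₁ (zero , here , refl)
∈-++⁻ (_ ∷ S) (there v∈) with ∈-++⁻ S v∈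
... | inj₁ (w , w∈ , refl) = inj₁ (suc w , there w∈ , refl)
... | inj₂ (w , w∈ , refl) = inj₂ (w , w∈ , refl)

imageSub-↑ˡ : ∀ {m n} (S : Subset m) → imageSub (_↑ˡ n) S ≡ S ++ ⊥
imageSub-↑ˡ {n = n} S = ⊆-antisym l⊆r r⊆l
  where
  l⊆r : ∀ {v} → v ∈ imageSub (_↑ˡ n) S → v ∈ S ++ ⊥
  l⊆r v∈ with ∈-imageSub⁻ (_↑ˡ n) S v∈
  ... | w , w∈ , refl = ∈-++⁺ˡ w∈
  r⊆l : ∀ {v} → v ∈ S ++ ⊥ → v ∈ imageSub (_↑ˡ n) S
  r⊆l v∈ with ∈-++⁻ S v∈
  ... | inj₁ (w , w∈ , refl) = ∈-imageSub⁺ (_↑ˡ n) w∈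
  ... | inj₂ (w , w∈ , refl) = ⊥-elim (∉⊥ w∈)

imageSub-↑ʳ : ∀ {m n} (S : Subset n) → imageSub (m ↑ʳ_) S ≡ ⊥ ++ S
imageSub-↑ʳ {m} S = ⊆-antisym l⊆r r⊆l
  where
  l⊆r : ∀ {v} → v ∈ imageSub (m ↑ʳ_) S → v ∈ ⊥ ++ S
  l⊆r v∈ with ∈-imageSub⁻ (m ↑ʳ_) S v∈
  ... | w , w∈ , refl = ∈-++⁺ʳ (⊥ {m}) w∈
  r⊆l : ∀ {v} → v ∈ ⊥ ++ S → v ∈ imageSub (m ↑ʳ_) S
  r⊆l v∈ with ∈-++⁻ (⊥ {m}) v∈
  ... | inj₁ (w , w∈ , refl) = ⊥-elim (∉⊥ w∈)
  ... | inj₂ (w , w∈ , refl) = ∈-imageSub⁺ (m ↑ʳ_) w∈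

⊗-gluing : ∀ {a₁ b₁ a₂ b₂} (f₁ : Cospan a₁ b₁) (f₂ : Cospan a₂ b₂) → Gluing f₁ f₂ (f₁ ⊗ f₂)
⊗-gluing {a₁} {b₁} {a₂} {b₂} f₁ f₂ = record
  { j₁ = record { αV = _↑ˡ nV₂ ; αE = _↑ˡ nE₂
                ; preserves = λ e → trans (cong [ _ , _ ]′ (splitAt-↑ˡ nE₁ e nE₂))
                                          (sym (imageSub-↑ˡ {n = nV₂} (ends (apex f₁) e))) }
  ; j₂ = record { αV = nV₁ ↑ʳ_ ; αE = nE₁ ↑ʳ_
                ; preserves = λ e → trans (cong [ _ , _ ]′ (splitAt-↑ʳ nE₁ nE₂ e))
                                          (sym (imageSub-↑ʳ {m = nV₁} (ends (apex f₂) e))) }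
  ; injective₁ = ↑ˡ-injective nE₂ _ _
  ; injective₂ = ↑ʳ-injective nE₁ _ _
  ; disjoint = ↑ˡ≢↑ʳ
  ; covering = covering
  ; boundary-reflected = boundary-reflected
  ; boundary-preserved₁ = λ where
      (inj₁ (i , refl)) → inj₁ (inj₁ (i ↑ˡ a₂ , cong [ _ , _ ]′ (splitAt-↑ˡ a₁ i a₂)))
      (inj₂ (j , refl)) → inj₁ (inj₂ (j ↑ˡ b₂ , cong [ _ , _ ]′ (splitAt-↑ˡ b₁ j b₂)))
  ; boundary-preserved₂ = λ where
      (inj₁ (i , refl)) → inj₁ (inj₁ (a₁ ↑ʳ i , cong [ _ , _ ]′ (splitAt-↑ʳ a₁ a₂ i)))
      (inj₂ (j , refl)) → inj₁ (inj₂ (b₁ ↑ʳ j , cong [ _ , _ ]′ (splitAt-↑ʳ b₁ b₂ j)))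
  ; glued-across₁ = λ {w} {u} eq → ⊥-elim (↑ˡ≢↑ʳ w u eq)
  ; glued-across₂ = λ {u} {w} eq → ⊥-elim (↑ˡ≢↑ʳ w u (sym eq))
  ; glued-within₁ = λ {w} {w'} eq w≢w' → ⊥-elim (w≢w' (↑ˡ-injective nV₂ w w' eq))
  ; glued-within₂ = λ {u} {u'} eq u≢u' → ⊥-elim (u≢u' (↑ʳ-injective nV₁ u u' eq))
  }
  where
  nV₁ nV₂ nE₁ nE₂ : ℕ
  nV₁ = nV (apex f₁)
  nV₂ = nV (apex f₂)
  nE₁ = nE (apex f₁)
  nE₂ = nE (apex f₂)

  covering : ∀ e → (∃ λ e₁ → e₁ ↑ˡ nE₂ ≡ e) ⊎ (∃ λ e₂ → nE₁ ↑ʳ e₂ ≡ e)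
  covering e with splitAt nE₁ e in eq
  ... | inj₁ e₁ = inj₁ (e₁ , splitAt⁻¹-↑ˡ eq)
  ... | inj₂ e₂ = inj₂ (e₂ , splitAt⁻¹-↑ʳ eq)

  boundary-reflected : ∀ {v} → InBoundary (f₁ ⊗ f₂) v →
    (∃ λ w → InBoundary f₁ w × w ↑ˡ nV₂ ≡ v) ⊎ (∃ λ u → InBoundary f₂ u × nV₁ ↑ʳ u ≡ v)
  boundary-reflected (inj₁ (i , eq)) with splitAt a₁ i
  ... | inj₁ i₁ = inj₁ (∂A f₁ i₁ , inj₁ (i₁ , refl) , eq)
  ... | inj₂ i₂ = inj₂ (∂A f₂ i₂ , inj₁ (i₂ , refl) , eq)
  boundary-reflected (inj₂ (j , eq)) with splitAt b₁ j
  ... | inj₁ j₁ = inj₁ (∂B f₁ j₁ , inj₂ (j₁ , refl) , eq)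
  ... | inj₂ j₂ = inj₂ (∂B f₂ j₂ , inj₂ (j₂ , refl) , eq)

-- Composites

edgeSum : ∀ {p} (G₁ G₂ : Hypergraph) → (Fin (nV G₁) → Fin p) → (Fin (nV G₂) → Fin p) → Hypergraph
edgeSum {p} G₁ G₂ k₁ k₂ = record
  { nV = p
  ; nE = nE G₁ + nE G₂
  ; ends = [ imageSub k₁ ∘ ends G₁ , imageSub k₂ ∘ ends G₂ ]′ ∘ splitAt (nE G₁)
  }

module _ {p} (G₁ G₂ : Hypergraph) (k₁ : Fin (nV G₁) → Fin p) (k₂ : Fin (nV G₂) → Fin p) where

  edgeSum-inj₁ : Hom G₁ (edgeSum G₁ G₂ k₁ k₂)
  edgeSum-inj₁ = record
    { αV = k₁ ; αE = _↑ˡ nE G₂ ; preserves = λ e → cong [ _ , _ ]′ (splitAt-↑ˡ (nE G₁) e (nE G₂)) }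

  edgeSum-inj₂ : Hom G₂ (edgeSum G₁ G₂ k₁ k₂)
  edgeSum-inj₂ = record
    { αV = k₂ ; αE = nE G₁ ↑ʳ_ ; preserves = λ e → cong [ _ , _ ]′ (splitAt-↑ʳ (nE G₁) (nE G₂) e) }

doubleEdges : Hypergraph → Hypergraph
doubleEdges H = record { nV = nV H ; nE = nE H + nE H ; ends = [ ends H , ends H ]′ ∘ splitAt (nE H) }

tag : ∀ {n} → Bool → Fin n → Fin (n + n)
tag {n} true  e = e ↑ˡ n
tag {n} false e = n ↑ʳ e

tagEdges : (H : Hypergraph) → (Fin (nE H) → Bool) → Hom H (doubleEdges H)
tagEdges H t = record
  { αV = id ; αE = λ e → tag (t e) e ; preserves = λ e → trans (ends-tag (t e) e) (sym (imageSub-id _)) }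
  where
  ends-tag : ∀ b e → ends (doubleEdges H) (tag b e) ≡ ends H e
  ends-tag true  e = cong [ _ , _ ]′ (splitAt-↑ˡ (nE H) e (nE H))
  ends-tag false e = cong [ _ , _ ]′ (splitAt-↑ʳ (nE H) (nE H) e)

indicator : ∀ {m} → Fin m → Fin m → Fin 2
indicator w v with v ≟ w
... | yes _ = suc zero
... | no  _ = zero

indicator-self : ∀ {m} (w : Fin m) → indicator w w ≡ suc zero
indicator-self w with w ≟ w
... | yes _   = refl
... | no  w≢w = ⊥-elim (w≢w refl)

indicator-other : ∀ {m} {w v : Fin m} → v ≢ w → indicator w v ≡ zero
indicator-other {w = w} {v} v≢w with v ≟ w
... | yes v≡w = ⊥-elim (v≢w v≡w)
... | no  _   = refl

indicator-one : ∀ {m} {w v : Fin m} → indicator w v ≡ suc zero → v ≡ w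
indicator-one {w = w} {v} eq with v ≟ w
... | yes v≡w = v≡w

module Composite {a y b} {f₁ : Cospan a y} {f₂ : Cospan y b} {h : Cospan a b} (c : IsComposite f₁ f₂ h) where

  open IsComposite c

  private
    J₁ : Fin (nV (apex f₁)) → Fin (nV (apex h))
    J₁ = αV j₁
    J₂ : Fin (nV (apex f₂)) → Fin (nV (apex h))
    J₂ = αV j₂
    nE₁ nE₂ : ℕ
    nE₁ = nE (apex f₁)
    nE₂ = nE (apex f₂)

    collapse : ∀ {n} → Fin n → Fin 1
    collapse _ = zero

    edge-sum-map : Σ (Hom (apex h) (edgeSum (apex f₁) (apex f₂) collapse collapse)) λ u →
                  (αE u ∘ αE j₁ ≗ (_↑ˡ nE₂)) × (αE u ∘ αE j₂ ≗ (nE₁ ↑ʳ_))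
    edge-sum-map with universal _ (edgeSum-inj₁ (apex f₁) (apex f₂) collapse collapse)
                                  (edgeSum-inj₂ (apex f₁) (apex f₂) collapse collapse) (λ _ → refl)
    ... | u , _ , uE₁ , _ , uE₂ = u , uE₁ , uE₂

  injective₁ : Injective _≡_ _≡_ (αE j₁)
  injective₁ {e} {e'} eq with edge-sum-map
  ... | u , uE₁ , _ = ↑ˡ-injective nE₂ e e' (trans (sym (uE₁ e)) (trans (cong (αE u) eq) (uE₁ e')))

  injective₂ : Injective _≡_ _≡_ (αE j₂)
  injective₂ {e} {e'} eq with edge-sum-map
  ... | u , _ , uE₂ = ↑ʳ-injective nE₁ e e' (trans (sym (uE₂ e)) (trans (cong (αE u) eq) (uE₂ e')))

  disjoint : ∀ e₁ e₂ → αE j₁ e₁ ≢ αE j₂ e₂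
  disjoint e₁ e₂ eq with edge-sum-map
  ... | u , uE₁ , uE₂ = ↑ˡ≢↑ʳ e₁ e₂ (trans (sym (uE₁ e₁)) (trans (cong (αE u) eq) (uE₂ e₂)))

  Covered : Fin (nE (apex h)) → Set
  Covered e = (∃ λ e₁ → αE j₁ e₁ ≡ e) ⊎ (∃ λ e₂ → αE j₂ e₂ ≡ e)

  -- Tagging the covered edges as left and the others as right agrees with tagging every
  -- edge as left on both parts, so the uniqueness of mediating maps leaves no edge uncovered.
  covering : ∀ e → Covered e
  covering e = tagged⇒covered e (proj₂ (unique _ (tagEdges _ (λ _ → true)) (tagEdges _ (⌊_⌋ ∘ covered?))
    (λ _ → refl) (λ e₁ → covered⇒tagged (inj₁ (e₁ , refl)))
    (λ _ → refl) (λ e₂ → covered⇒tagged (inj₂ (e₂ , refl)))) e)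
    where
    covered? : ∀ e → Dec (Covered e)
    covered? e = any? (λ e₁ → αE j₁ e₁ ≟ e) ⊎-dec any? (λ e₂ → αE j₂ e₂ ≟ e)
    covered⇒tagged : ∀ {e} → Covered e → tag true e ≡ tag ⌊ covered? e ⌋ e
    covered⇒tagged {e} cov with covered? e
    ... | yes _ = refl
    ... | no ¬cov = ⊥-elim (¬cov cov)
    tagged⇒covered : ∀ e → tag true e ≡ tag ⌊ covered? e ⌋ e → Covered e
    tagged⇒covered e eq with covered? e
    ... | yes cov = cov
    ... | no  _   = ⊥-elim (↑ˡ≢↑ʳ e e eq)

  private
    1≢0 : _≢_ {A = Fin 2} (suc zero) zero
    1≢0 ()

    -- A vertex w that is not glued can be coloured 1 and every other vertex 0 compatibly with
    -- the pushout, so nothing else is identified with it in the apex of h.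
    unglued₁ : ∀ {w} → ¬ (∃ λ i → ∂B f₁ i ≡ w) → (∀ {w'} → J₁ w' ≡ J₁ w → w' ≡ w) × (∀ {u} → J₂ u ≢ J₁ w)
    unglued₁ {w} w∉∂B with universal _ (edgeSum-inj₁ (apex f₁) (apex f₂) (indicator w) (λ _ → zero))
                                         (edgeSum-inj₂ (apex f₁) (apex f₂) (indicator w) (λ _ → zero))
                                         (λ i → indicator-other (w∉∂B ∘ (i ,_)))
    ... | s , sJ₁ , _ , sJ₂ , _ = fibre , apart
      where
      colour-w : αV s (J₁ w) ≡ suc zero
      colour-w = trans (sJ₁ w) (indicator-self w)
      fibre : ∀ {w'} → J₁ w' ≡ J₁ w → w' ≡ w
      fibre {w'} eq = indicator-one (trans (sym (sJ₁ w')) (trans (cong (αV s) eq) colour-w))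
      apart : ∀ {u} → J₂ u ≢ J₁ w
      apart {u} eq = 1≢0 (trans (sym colour-w) (trans (cong (αV s) (sym eq)) (sJ₂ u)))

    unglued₂ : ∀ {u} → ¬ (∃ λ i → ∂A f₂ i ≡ u) → (∀ {u'} → J₂ u' ≡ J₂ u → u' ≡ u) × (∀ {w} → J₁ w ≢ J₂ u)
    unglued₂ {u} u∉∂A with universal _ (edgeSum-inj₁ (apex f₁) (apex f₂) (λ _ → zero) (indicator u))
                                         (edgeSum-inj₂ (apex f₁) (apex f₂) (λ _ → zero) (indicator u))
                                         (λ i → sym (indicator-other (u∉∂A ∘ (i ,_))))
    ... | s , sJ₁ , _ , sJ₂ , _ = fibre , apart
      where
      colour-u : αV s (J₂ u) ≡ suc zero
      colour-u = trans (sJ₂ u) (indicator-self u)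
      fibre : ∀ {u'} → J₂ u' ≡ J₂ u → u' ≡ u
      fibre {u'} eq = indicator-one (trans (sym (sJ₂ u')) (trans (cong (αV s) eq) colour-u))
      apart : ∀ {w} → J₁ w ≢ J₂ u
      apart {w} eq = 1≢0 (trans (sym colour-u) (trans (cong (αV s) (sym eq)) (sJ₁ w)))

    glued₁ : ∀ {w} → ¬ ¬ (∃ λ i → ∂B f₁ i ≡ w) → InBoundary f₁ w
    glued₁ {w} = inj₂ ∘ decidable-stable (any? λ i → ∂B f₁ i ≟ w)

    glued₂ : ∀ {u} → ¬ ¬ (∃ λ i → ∂A f₂ i ≡ u) → InBoundary f₂ u
    glued₂ {u} = inj₁ ∘ decidable-stable (any? λ i → ∂A f₂ i ≟ u)

  glued-within₁ : ∀ {w w'} → J₁ w ≡ J₁ w' → w ≢ w' → InBoundary f₁ w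
  glued-within₁ eq w≢w' = glued₁ λ w∉∂B → w≢w' (sym (proj₁ (unglued₁ w∉∂B) (sym eq)))

  glued-within₂ : ∀ {u u'} → J₂ u ≡ J₂ u' → u ≢ u' → InBoundary f₂ u
  glued-within₂ eq u≢u' = glued₂ λ u∉∂A → u≢u' (sym (proj₁ (unglued₂ u∉∂A) (sym eq)))

  glued-across₁ : ∀ {w u} → J₁ w ≡ J₂ u → InBoundary f₁ w
  glued-across₁ eq = glued₁ λ w∉∂B → proj₂ (unglued₁ w∉∂B) (sym eq)

  glued-across₂ : ∀ {u w} → J₂ u ≡ J₁ w → InBoundary f₂ u
  glued-across₂ eq = glued₂ λ u∉∂A → proj₂ (unglued₂ u∉∂A) (sym eq)

  gluing : Gluing f₁ f₂ h
  gluing = record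
    { j₁ = j₁
    ; j₂ = j₂
    ; injective₁ = injective₁
    ; injective₂ = injective₂
    ; disjoint = disjoint
    ; covering = covering
    ; boundary-reflected = λ where
        (inj₁ (i , eq)) → inj₁ (∂A f₁ i , inj₁ (i , refl) , trans (sym (legA i)) eq)
        (inj₂ (j , eq)) → inj₂ (∂B f₂ j , inj₂ (j , refl) , trans (sym (legB j)) eq)
    ; boundary-preserved₁ = λ where
        (inj₁ (i , refl)) → inj₁ (inj₁ (i , legA i))
        (inj₂ (j , refl)) → inj₂ (∂A f₂ j , glue j)
    ; boundary-preserved₂ = λ where
        (inj₁ (i , refl)) → inj₂ (∂B f₁ i , sym (glue i))
        (inj₂ (j , refl)) → inj₁ (inj₂ (j , legB j))
    ; glued-across₁ = glued-across₁
    ; glued-across₂ = glued-across₂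
    ; glued-within₁ = glued-within₁
    ; glued-within₂ = glued-within₂
    }

+≤2* : ∀ {m n o} → m ≤ o → n ≤ o → m + n ≤ 2 * o
+≤2* {o = o} m≤o n≤o = ≤-trans (+-mono-≤ m≤o n≤o) (≤-reflexive (cong (o +_) (sym (+-identityʳ o))))

decomposable : ∀ {a b} {h : Cospan a b} (d : MDec h) {M} → wd d ≤ M → a ≤ M → b ≤ M → Decomposable h (2 * M)
decomposable (leaf f) wd≤M _ _ =
  decomposable-mono f (≤-trans wd≤M (m≤m+n _ _)) (decomposable-atom f)
decomposable (tens {a₁} {b₁} d₁ d₂ f≅f₁⊗f₂) wd≤M a≤M b≤M =
  decomposable-≅ f≅f₁⊗f₂ (decomposable-glue (⊗-gluing _ _)
    (decomposable d₁ (m⊔n≤o⇒m≤o (wd d₁) (wd d₂) wd≤M) (m+n≤o⇒m≤o a₁ a≤M) (m+n≤o⇒m≤o b₁ b≤M))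
    (decomposable d₂ (m⊔n≤o⇒n≤o (wd d₁) (wd d₂) wd≤M) (m+n≤o⇒n≤o a₁ a≤M) (m+n≤o⇒n≤o b₁ b≤M))
    (+≤2* a≤M b≤M))
decomposable (seq {y = y} d₁ d₂ c) {M} wd≤M a≤M b≤M =
  decomposable-glue (Composite.gluing c)
    (decomposable d₁ (m⊔n≤o⇒m≤o (wd d₁) y wd₁⊔y≤M) a≤M (m⊔n≤o⇒n≤o (wd d₁) y wd₁⊔y≤M))
    (decomposable d₂ (m⊔n≤o⇒n≤o (wd d₁ ⊔ y) (wd d₂) wd≤M) (m⊔n≤o⇒n≤o (wd d₁) y wd₁⊔y≤M) b≤M)
    (+≤2* a≤M b≤M)
  where
  wd₁⊔y≤M : wd d₁ ⊔ y ≤ M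
  wd₁⊔y≤M = m⊔n≤o⇒m≤o (wd d₁ ⊔ y) (wd d₂) wd≤M

proposition3p33 : ∀ {a b n : ℕ} (h : Cospan a b) (φ : Fin (nV (apex h)) → Fin n)
    → (∀ w w' → w ≢ w' → φ w ≡ φ w' → InBoundary h w × InBoundary h w')
    → (d : MDec h)
    → Σ (IBD (Γhyp h φ) (imageSub φ ⊤) ⊤ (Γsources h φ)) λ T →
        wdT T ≤ 2 * (wd d ⊔ a ⊔ b)
proposition3p33 {a} {b} h φ identifiesOnlyBoundary d =
  IBD≤-cast refl (imageSub-id ⊤) refl
    (decomposable d (m≤n⇒m≤n⊔o b (m≤m⊔n (wd d) a)) (m≤n⇒m≤n⊔o b (m≤n⊔m (wd d) a)) (m≤n⊔m (wd d ⊔ a) b)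
      embedding (λ eq → eq) identifiesOnlyBoundary)
  where
  embedding : Hom (apex h) (Γhyp h φ)
  embedding = record { αV = φ ; αE = λ e → e ; preserves = λ _ → refl }
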